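{- For a non-negative integer $n$, let $[n]$ denote the sum of the $3$-adic digits of $n$. Let $r\geq2$ and let $x$ be an integer with $0\leq x<3^r$ such that $x\not\equiv2$ and $x\not\equiv6\pmod 9$. Then $$\left[23x+\tfrac{3^r-1}{2}\right]\leq[x]+\left[2x+2+\tfrac{3^r-1}{2}\right]+2.$$ -}

module Defs where

open import Data.Nat using (ℕ; zero; suc; _+_; _/_; _%_)

-- Sum of base-3 digits, computed with fuel; with fuel ≥ n the result is
-- the true 3-adic digit sum of n (each step strictly decreases n when n > 0).
digitSum3-fuel : ℕ → ℕ → ℕ
digitSum3-fuel zero    n = 0
digitSum3-fuel (suc k) n = n % 3 + digitSum3-fuel k (n / 3)

digitSum3 : ℕ → ℕ
digitSum3 n = digitSum3-fuel n n

{-# OPTIONS --safe #-}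
-- Every base-3 digit of (3^r − 1)/2 is 1, so adding it to 23x and to 2x + 2 is
-- a transducer reading the digits a of x from the bottom: its state is the pair
-- of carries (c, d), with c ≤ 23 and d ≤ 2, and it emits the digits
-- e₂₃ = (23a + 1 + c) mod 3 and e₂ = (2a + 1 + d) mod 3 of the two sums.
-- A potential Φ on the 72 states serves as a finite certificate: every step
-- satisfies e₂₃ + Φ(c, d) ≤ a + e₂ + Φ(c′, d′), and the final carries satisfy
-- [c] + Φ(c, d) ≤ [d] + 8.  Summing along the run gives
-- [23x + c + N] + Φ(c, d) ≤ [x] + [2x + d + N] + 8 for all x < 3^r.  When
-- x ≢ 2, 6 (mod 9), the first two steps from the initial state (0, 2) gain 6
-- over the potential, which brings the constant down to 2.
module Submission where

open import Defs
open import Algebra.Properties.CommutativeSemigroup using (interchange)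
open import Data.Fin using (toℕ; fromℕ<)
open import Data.Fin.Properties using (all?; toℕ-fromℕ<; toℕ<n)
open import Data.List using (List; []; _∷_; head; drop)
open import Data.Maybe using (fromMaybe)
open import Data.Nat using (ℕ; zero; suc; _+_; _*_; _∸_; _^_; _/_; _%_; _≤_; _<_; _≤?_; _≟_; s≤s; s≤s⁻¹; s<s; z<s)
open import Data.Nat.DivMod
open import Data.Nat.Divisibility using (divides)
open import Data.Nat.Properties
open import Data.Nat.Tactic.RingSolver using (solve-∀)
open import Relation.Binary.PropositionalEquality
open import Relation.Nullary.Decidable using (Dec; map′; toWitness; ¬?; _→-dec_)
open import Relation.Unary using (Decidable)

∀<? : ∀ n {p} {P : ℕ → Set p} → Decidable P → Dec (∀ {m} → m < n → P m)
∀<? n {P = P} P? = map′ (λ h m<n → subst P (toℕ-fromℕ< m<n) (h (fromℕ< m<n)))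
                          (λ h i → h (toℕ<n i))
                          (all? (λ i → P? (toℕ i)))

+-telescope-≤ : ∀ x x′ f f′ {y y′ k} → x + f ≤ y + f′ → x′ + f′ ≤ y′ + k →
                x + x′ + f ≤ y + y′ + k
+-telescope-≤ x x′ f f′ {y} {y′} {k} h h′ = +-cancelʳ-≤ f′ _ _ (begin
  x + x′ + f + f′       ≡⟨ regroupˡ x x′ f f′ ⟩
  (x + f) + (x′ + f′)   ≤⟨ +-mono-≤ h h′ ⟩
  (y + f′) + (y′ + k)   ≡⟨ regroupʳ y y′ f′ k ⟩
  y + y′ + k + f′       ∎)
  where
  open ≤-Reasoning
  regroupˡ : ∀ x x′ f f′ → x + x′ + f + f′ ≡ (x + f) + (x′ + f′)
  regroupˡ = solve-∀
  regroupʳ : ∀ y y′ f′ k → (y + f′) + (y′ + k) ≡ y + y′ + k + f′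
  regroupʳ = solve-∀

digitSum3-fuel-zero : ∀ k → digitSum3-fuel k 0 ≡ 0
digitSum3-fuel-zero zero    = refl
digitSum3-fuel-zero (suc k) = digitSum3-fuel-zero k

suc-/3-≤ : ∀ {n k} → suc n ≤ suc k → suc n / 3 ≤ k
suc-/3-≤ {n} n<k = ≤-trans (s≤s⁻¹ (m/n<m (suc n) 3 (s<s z<s))) (s≤s⁻¹ n<k)

digitSum3-fuel-irrelevant : ∀ k l n → n ≤ k → n ≤ l →
                            digitSum3-fuel k n ≡ digitSum3-fuel l n
digitSum3-fuel-irrelevant k       l       zero    _   _   =
  trans (digitSum3-fuel-zero k) (sym (digitSum3-fuel-zero l))
digitSum3-fuel-irrelevant (suc k) (suc l) (suc n) n≤k n≤l =
  cong (suc n % 3 +_)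
       (digitSum3-fuel-irrelevant k l (suc n / 3) (suc-/3-≤ n≤k) (suc-/3-≤ n≤l))

digitSum3-unfold : ∀ n → digitSum3 n ≡ n % 3 + digitSum3 (n / 3)
digitSum3-unfold zero    = refl
digitSum3-unfold (suc n) =
  cong (suc n % 3 +_)
       (digitSum3-fuel-irrelevant n (suc n / 3) (suc n / 3) (suc-/3-≤ ≤-refl) ≤-refl)

digitSum3-+-3* : ∀ t y → digitSum3 (t + 3 * y) ≡ t % 3 + digitSum3 (t / 3 + y)
digitSum3-+-3* t y = begin
  digitSum3 (t + 3 * y)
    ≡⟨ cong (λ z → digitSum3 (t + z)) (*-comm 3 y) ⟩
  digitSum3 (t + y * 3)
    ≡⟨ digitSum3-unfold (t + y * 3) ⟩
  (t + y * 3) % 3 + digitSum3 ((t + y * 3) / 3)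
    ≡⟨ cong₂ (λ a b → a + digitSum3 b) ([m+kn]%n≡m%n t y 3) t+3y/3 ⟩
  t % 3 + digitSum3 (t / 3 + y) ∎
  where
  open ≡-Reasoning
  t+3y/3 : (t + y * 3) / 3 ≡ t / 3 + y
  t+3y/3 = trans (+-distrib-/-∣ʳ t (divides y refl)) (cong (t / 3 +_) (m*n/n≡m y 3))

repunit3 : ℕ → ℕ
repunit3 zero    = 0
repunit3 (suc r) = 1 + 3 * repunit3 r

3^r≡1+2*repunit3 : ∀ r → 3 ^ r ≡ 1 + 2 * repunit3 r
3^r≡1+2*repunit3 zero    = refl
3^r≡1+2*repunit3 (suc r) = trans (cong (3 *_) (3^r≡1+2*repunit3 r)) (3[1+2n]≡1+2[1+3n] (repunit3 r))
  where
  3[1+2n]≡1+2[1+3n] : ∀ n → 3 * (1 + 2 * n) ≡ 1 + 2 * (1 + 3 * n)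
  3[1+2n]≡1+2[1+3n] = solve-∀

[3^r∸1]/2≡repunit3 : ∀ r → (3 ^ r ∸ 1) / 2 ≡ repunit3 r
[3^r∸1]/2≡repunit3 r rewrite 3^r≡1+2*repunit3 r =
  trans (cong (_/ 2) (*-comm 2 (repunit3 r))) (m*n/n≡m (repunit3 r) 2)

column : ℕ → ℕ → ℕ → ℕ
column m a c = m * a + 1 + c

digitSum3-carry-step : ∀ m r x c →
  digitSum3 (m * x + c + repunit3 (suc r))
    ≡ column m (x % 3) c % 3 + digitSum3 (m * (x / 3) + column m (x % 3) c / 3 + repunit3 r)
digitSum3-carry-step m r x c = begin
  digitSum3 (m * x + c + repunit3 (suc r))
    ≡⟨ cong (λ z → digitSum3 (m * z + c + repunit3 (suc r))) x≡a+3q ⟩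
  digitSum3 (m * (a + 3 * q) + c + (1 + 3 * n))
    ≡⟨ cong digitSum3 (split m a q c n) ⟩
  digitSum3 (column m a c + 3 * (m * q + n))
    ≡⟨ digitSum3-+-3* (column m a c) (m * q + n) ⟩
  column m a c % 3 + digitSum3 (column m a c / 3 + (m * q + n))
    ≡⟨ cong (λ z → column m a c % 3 + digitSum3 z) (shift (column m a c / 3) (m * q) n) ⟩
  column m a c % 3 + digitSum3 (m * q + column m a c / 3 + n) ∎
  where
  open ≡-Reasoning
  a = x % 3
  q = x / 3
  n = repunit3 r
  x≡a+3q : x ≡ a + 3 * q
  x≡a+3q = trans (m≡m%n+[m/n]*n x 3) (cong (a +_) (*-comm q 3))
  split : ∀ m a q c n → m * (a + 3 * q) + c + (1 + 3 * n) ≡ (m * a + 1 + c) + 3 * (m * q + n)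
  split = solve-∀
  shift : ∀ k l n → k + (l + n) ≡ l + k + n
  shift = solve-∀

digitSum3-carry-step² : ∀ m r x c →
  let u = column m (x % 3) c ; v = column m (x / 3 % 3) (u / 3) in
  digitSum3 (m * x + c + repunit3 (2 + r))
    ≡ u % 3 + (v % 3 + digitSum3 (m * (x / 3 / 3) + v / 3 + repunit3 r))
digitSum3-carry-step² m r x c =
  trans (digitSum3-carry-step m (suc r) x c)
        (cong (column m (x % 3) c % 3 +_)
              (digitSum3-carry-step m r (x / 3) (column m (x % 3) c / 3)))

carry-< : ∀ m a c → a < 3 → c < suc m → column m a c / 3 < suc m
carry-< m a c a<3 c<1+m = m<n*o⇒m/o<n (begin-strict
  m * a + 1 + c  ≤⟨ +-mono-≤ (+-monoˡ-≤ 1 (*-monoʳ-≤ m (s≤s⁻¹ a<3))) (s≤s⁻¹ c<1+m) ⟩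
  m * 2 + 1 + m  <⟨ m<m+n (m * 2 + 1 + m) z<s ⟩
  m * 2 + 1 + m + 2 ≡⟨ m*2+1+m+2≡[1+m]*3 m ⟩
  suc m * 3      ∎)
  where
  open ≤-Reasoning
  m*2+1+m+2≡[1+m]*3 : ∀ m → m * 2 + 1 + m + 2 ≡ suc m * 3
  m*2+1+m+2≡[1+m]*3 = solve-∀

-- Row c, column d holds the potential of the carries (c, d) of 23x and 2x.
potential : ℕ → ℕ → ℕ
potential c d = fromMaybe 0 (head (drop (3 * c + d) table))
  where
  table : List ℕ
  table =
    6 ∷ 3 ∷ 2 ∷
    5 ∷ 4 ∷ 1 ∷
    4 ∷ 3 ∷ 4 ∷
    5 ∷ 2 ∷ 3 ∷
    4 ∷ 5 ∷ 2 ∷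
    3 ∷ 4 ∷ 3 ∷
    4 ∷ 5 ∷ 2 ∷
    3 ∷ 4 ∷ 1 ∷
    4 ∷ 5 ∷ 2 ∷
    5 ∷ 4 ∷ 1 ∷
    4 ∷ 5 ∷ 0 ∷
    3 ∷ 4 ∷ 5 ∷
    4 ∷ 3 ∷ 4 ∷
    3 ∷ 4 ∷ 3 ∷
    2 ∷ 3 ∷ 4 ∷
    3 ∷ 4 ∷ 3 ∷
    2 ∷ 3 ∷ 2 ∷
    3 ∷ 4 ∷ 5 ∷
    4 ∷ 3 ∷ 4 ∷
    3 ∷ 4 ∷ 3 ∷
    2 ∷ 3 ∷ 4 ∷
    3 ∷ 2 ∷ 3 ∷
    2 ∷ 3 ∷ 2 ∷
    3 ∷ 4 ∷ 5 ∷
    []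

DigitStepPaid : ℕ → ℕ → ℕ → Set
DigitStepPaid a c d =
  column 23 a c % 3 + potential c d
    ≤ a + column 2 a d % 3 + potential (column 23 a c / 3) (column 2 a d / 3)

potential-step : ∀ {a} → a < 3 → ∀ {c} → c < 24 → ∀ {d} → d < 3 → DigitStepPaid a c d
potential-step = toWitness {a? = ∀<? 3 λ a → ∀<? 24 λ c → ∀<? 3 (paid? a c)} _
  where
  paid? : ∀ a c d → Dec (DigitStepPaid a c d)
  paid? _ _ _ = _ ≤? _

potential-final : ∀ {c} → c < 24 → ∀ {d} → d < 3 →
                  digitSum3 c + potential c d ≤ digitSum3 d + 8
potential-final = toWitness {a? = ∀<? 24 λ c → ∀<? 3 (paid? c)} _
  where
  paid? : ∀ c d → Dec (digitSum3 c + potential c d ≤ digitSum3 d + 8)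
  paid? _ _ = _ ≤? _

TwoDigitGain : ℕ → ℕ → Set
TwoDigitGain a₀ a₁ =
  u₀ % 3 + u₁ % 3 + 6 ≤ a₀ + a₁ + v₀ % 3 + v₁ % 3 + potential (u₁ / 3) (v₁ / 3)
  where
  u₀ = column 23 a₀ 0
  v₀ = column 2 a₀ 2
  u₁ = column 23 a₁ (u₀ / 3)
  v₁ = column 2 a₁ (v₀ / 3)

two-digit-gain : ∀ {k} → k < 9 → k ≢ 2 → k ≢ 6 → TwoDigitGain (k % 3) (k / 3)
two-digit-gain = toWitness {a? = ∀<? 9 λ k → ¬? (k ≟ 2) →-dec ¬? (k ≟ 6) →-dec gain? k} _
  where
  gain? : ∀ k → Dec (TwoDigitGain (k % 3) (k / 3))
  gain? _ = _ ≤? _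

m<3^[1+r]⇒m/3<3^r : ∀ r {m} → m < 3 ^ suc r → m / 3 < 3 ^ r
m<3^[1+r]⇒m/3<3^r r {m} m<3^[1+r] = m<n*o⇒m/o<n (subst (m <_) (*-comm 3 (3 ^ r)) m<3^[1+r])

digitSum3-23*-bound : ∀ r {x c d} → x < 3 ^ r → c < 24 → d < 3 →
  digitSum3 (23 * x + c + repunit3 r) + potential c d
    ≤ digitSum3 x + digitSum3 (2 * x + d + repunit3 r) + 8
digitSum3-23*-bound zero {zero} {c} {d} _ c<24 d<3 =
  subst₂ (λ c′ d′ → digitSum3 c′ + potential c d ≤ digitSum3 d′ + 8)
         (sym (+-identityʳ c)) (sym (+-identityʳ d)) (potential-final c<24 d<3)
digitSum3-23*-bound zero {suc _} (s≤s ()) _ _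
digitSum3-23*-bound (suc r) {x} {c} {d} x<3^[1+r] c<24 d<3 = begin
  digitSum3 (23 * x + c + repunit3 (suc r)) + potential c d
    ≡⟨ cong (_+ potential c d) (digitSum3-carry-step 23 r x c) ⟩
  u % 3 + A + potential c d
    ≤⟨ +-telescope-≤ (u % 3) A (potential c d) (potential (u / 3) (v / 3))
                     (potential-step a<3 c<24 d<3)
                     (digitSum3-23*-bound r (m<3^[1+r]⇒m/3<3^r r x<3^[1+r])
                                            (carry-< 23 a c a<3 c<24) (carry-< 2 a d a<3 d<3)) ⟩
  a + v % 3 + (digitSum3 q + B) + 8
    ≡⟨ cong (_+ 8) (interchange +-commutativeSemigroup a (v % 3) (digitSum3 q) B) ⟩
  a + digitSum3 q + (v % 3 + B) + 8
    ≡⟨ cong₂ (λ s t → s + t + 8) (sym (digitSum3-unfold x)) (sym (digitSum3-carry-step 2 r x d)) ⟩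
  digitSum3 x + digitSum3 (2 * x + d + repunit3 (suc r)) + 8 ∎
  where
  open ≤-Reasoning
  a = x % 3
  q = x / 3
  u = column 23 a c
  v = column 2 a d
  A = digitSum3 (23 * q + u / 3 + repunit3 r)
  B = digitSum3 (2 * q + v / 3 + repunit3 r)
  a<3 : a < 3
  a<3 = m%n<n x 3

corollary3p4 : (r x : ℕ) → 2 ≤ r → x < 3 ^ r → x % 9 ≢ 2 → x % 9 ≢ 6 →
    digitSum3 (23 * x + (3 ^ r ∸ 1) / 2)
      ≤ digitSum3 x + digitSum3 (2 * x + 2 + (3 ^ r ∸ 1) / 2) + 2
corollary3p4 (suc (suc r)) x (s≤s (s≤s _)) x<3^r x%9≢2 x%9≢6
  rewrite [3^r∸1]/2≡repunit3 (2 + r) = +-cancelʳ-≤ 6 _ _ (begin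
  digitSum3 (23 * x + N) + 6
    ≡⟨ cong (λ y → digitSum3 (y + N) + 6) (sym (+-identityʳ (23 * x))) ⟩
  digitSum3 (23 * x + 0 + N) + 6
    ≡⟨ cong (_+ 6) (digitSum3-carry-step² 23 r x 0) ⟩
  u₀ % 3 + (u₁ % 3 + A) + 6
    ≡⟨ cong (_+ 6) (sym (+-assoc (u₀ % 3) (u₁ % 3) A)) ⟩
  u₀ % 3 + u₁ % 3 + A + 6
    ≤⟨ +-telescope-≤ (u₀ % 3 + u₁ % 3) A 6 (potential (u₁ / 3) (v₁ / 3))
                     gain (digitSum3-23*-bound r q<3^r c₂<24 d₂<3) ⟩
  a₀ + a₁ + v₀ % 3 + v₁ % 3 + (digitSum3 q + B) + 8
    ≡⟨ regroup a₀ a₁ (v₀ % 3) (v₁ % 3) (digitSum3 q) B ⟩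
  a₀ + (a₁ + digitSum3 q) + (v₀ % 3 + (v₁ % 3 + B)) + 2 + 6
    ≡⟨ cong₂ (λ s t → s + t + 2 + 6) (sym x-digits) (sym (digitSum3-carry-step² 2 r x 2)) ⟩
  digitSum3 x + digitSum3 (2 * x + 2 + N) + 2 + 6 ∎)
  where
  open ≤-Reasoning
  N = repunit3 (2 + r)
  a₀ = x % 3
  a₁ = x / 3 % 3
  q = x / 3 / 3
  u₀ = column 23 a₀ 0
  v₀ = column 2 a₀ 2
  u₁ = column 23 a₁ (u₀ / 3)
  v₁ = column 2 a₁ (v₀ / 3)
  A = digitSum3 (23 * q + u₁ / 3 + repunit3 r)
  B = digitSum3 (2 * q + v₁ / 3 + repunit3 r)
  gain : TwoDigitGain a₀ a₁
  gain = subst₂ TwoDigitGain (m∣n⇒o%n%m≡o%m 3 9 x (divides 3 refl)) (m%[n*o]/o≡m/o%n x 3 3)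
                (two-digit-gain (m%n<n x 9) x%9≢2 x%9≢6)
  q<3^r : q < 3 ^ r
  q<3^r = m<3^[1+r]⇒m/3<3^r r (m<3^[1+r]⇒m/3<3^r (suc r) x<3^r)
  c₂<24 : u₁ / 3 < 24
  c₂<24 = carry-< 23 a₁ (u₀ / 3) (m%n<n (x / 3) 3) (carry-< 23 a₀ 0 (m%n<n x 3) z<s)
  d₂<3 : v₁ / 3 < 3
  d₂<3 = carry-< 2 a₁ (v₀ / 3) (m%n<n (x / 3) 3) (carry-< 2 a₀ 2 (m%n<n x 3) (s<s (s<s z<s)))
  x-digits : digitSum3 x ≡ a₀ + (a₁ + digitSum3 q)
  x-digits = trans (digitSum3-unfold x) (cong (a₀ +_) (digitSum3-unfold (x / 3)))
  regroup : ∀ a₀ a₁ v₀ v₁ s t →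
            a₀ + a₁ + v₀ + v₁ + (s + t) + 8 ≡ a₀ + (a₁ + s) + (v₀ + (v₁ + t)) + 2 + 6
  regroup = solve-∀
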